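{- Let $S_1,\dots,S_8$ be the following $4$-cycle systems of $K_9$ (each cycle $abcd$ listed by its vertices in cyclic order): $S_1$: 1234, 1356, 1527, 1829, 2476, 3648, 3759, 4589, 6879; $S_2$: 1234, 1356, 1527, 1829, 2476, 3687, 3849, 4596, 5798; $S_3$: 1234, 1356, 1527, 1829, 2486, 3647, 3859, 4579, 6789; $S_4$: 1234, 1356, 1527, 1829, 2486, 3647, 3879, 4589, 5769; $S_5$: 1234, 1356, 1527, 1829, 2486, 3678, 3749, 4596, 5798; $S_6$: 1234, 1356, 1527, 1829, 2486, 3678, 3759, 4589, 4697; $S_7$: 1234, 1356, 1527, 1829, 2486, 3698, 3749, 4576, 5879; $S_8$: 1234, 1356, 1527, 1849, 2458, 2689, 3678, 3759, 4697. Then for every $i,j\in\{1,\dots,8\}$ and every permutation $\sigma$ of $\{1,\dots,9\}$ there exists a path between $S_j$ and $S_i^{\sigma}$ in which each edge is a $4$-cycle bitrade of volume $2$ or $3$.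
   Context: A $4$-cycle $abcd$ has vertices $a,b,c,d$ and edges $\{a,b\},\{b,c\},\{c,d\},\{d,a\}$; cycles are identified with their edge sets. A $4$-cycle system of order $9$ is a collection of $4$-cycles whose edge sets partition the edges of $K_9$ on $\{1,\dots,9\}$. A $4$-cycle bitrade $(T,T')$ of volume $s$ is a pair of disjoint sets of $s$ pairwise edge-disjoint $4$-cycles covering the same edge set. A path between $4$-cycle systems $A$ and $B$ is a sequence $A=C_0,\dots,C_m=B$ of $4$-cycle systems such that each $C_k$ is obtained from $C_{k-1}$ by a bitrade $(T,T')$ with $T\subseteq C_{k-1}$ and $C_k=(C_{k-1}\setminus T)\cup T'$ (these bitrades are the edges of the path). For a set $X$ of $4$-cycles and a permutation $\sigma$, $X^{\sigma}$ is obtained by applying $\sigma$ to every vertex of every cycle of $X$. -}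

module Defs where

open import Data.Nat using (ℕ; zero; suc)
open import Data.Fin using (Fin; zero; suc)
open import Data.Fin.Permutation using (Permutation′; _⟨$⟩ʳ_)
open import Data.List using (List; []; _∷_; length; lookup; map)
open import Data.List.Relation.Unary.All using (All)
open import Data.List.Relation.Unary.Any using (Any)
open import Data.Product using (Σ; ∃; ∃-syntax; _×_; _,_)
open import Data.Sum using (_⊎_)
open import Relation.Nullary using (¬_)
open import Relation.Binary.PropositionalEquality using (_≡_; _≢_)
open import Function.Bundles using (_⇔_)

-- Vertices of K₉: Fin 9, where Fin value k represents vertex k+1.
Vertex : Set
Vertex = Fin 9

record Cycle : Set where
  constructor cyc
  field
    a b c d : Vertex
open Cycle public

IsCycle : Cycle → Set
IsCycle (cyc a b c d) =
  a ≢ b × a ≢ c × a ≢ d × b ≢ c × b ≢ d × c ≢ d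

SamePair : Vertex → Vertex → Vertex → Vertex → Set
SamePair x y u v = (x ≡ u × y ≡ v) ⊎ (x ≡ v × y ≡ u)

HasEdge : Cycle → Vertex → Vertex → Set
HasEdge (cyc a b c d) x y =
  SamePair x y a b ⊎ SamePair x y b c ⊎ SamePair x y c d ⊎ SamePair x y d a

-- Cycles are identified with their edge sets.
SameCycle : Cycle → Cycle → Set
SameCycle X Y = ∀ x y → HasEdge X x y ⇔ HasEdge Y x y

_∈c_ : Cycle → List Cycle → Set
X ∈c L = Any (SameCycle X) L

_⊆c_ : List Cycle → List Cycle → Set
L ⊆c M = ∀ X → X ∈c L → X ∈c M

_≈c_ : List Cycle → List Cycle → Set
L ≈c M = ∀ X → X ∈c L ⇔ X ∈c M

Covers : List Cycle → Vertex → Vertex → Set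
Covers L x y = Any (λ X → HasEdge X x y) L

PairwiseEdgeDisjoint : List Cycle → Set
PairwiseEdgeDisjoint L =
  ∀ (i j : Fin (length L)) → i ≢ j → ∀ x y →
    ¬ (HasEdge (lookup L i) x y × HasEdge (lookup L j) x y)

IsSystem : List Cycle → Set
IsSystem L =
  All IsCycle L ×
  (∀ x y → x ≢ y →
     Σ (Fin (length L)) λ i →
       HasEdge (lookup L i) x y ×
       (∀ j → HasEdge (lookup L j) x y → j ≡ i))

IsBitrade : ℕ → List Cycle → List Cycle → Set
IsBitrade s T T' =
  length T ≡ s × length T' ≡ s ×
  All IsCycle T × All IsCycle T' ×
  PairwiseEdgeDisjoint T × PairwiseEdgeDisjoint T' ×
  (∀ X → X ∈c T → ¬ (X ∈c T')) ×
  (∀ x y → Covers T x y ⇔ Covers T' x y)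

Vol23 : ℕ → Set
Vol23 s = (s ≡ 2) ⊎ (s ≡ 3)

Step : List Cycle → List Cycle → Set
Step C C' =
  Σ ℕ λ s → Vol23 s ×
  Σ (List Cycle) λ T → Σ (List Cycle) λ T' →
    IsBitrade s T T' × T ⊆c C × IsSystem C' ×
    (∀ X → X ∈c C' ⇔ ((X ∈c C × ¬ (X ∈c T)) ⊎ X ∈c T'))

data Path : List Cycle → List Cycle → Set where
  done : ∀ {A B} → IsSystem A → A ≈c B → Path A B
  step : ∀ {A C B} → Step A C → Path C B → Path A B

applyC : Permutation′ 9 → Cycle → Cycle
applyC σ (cyc a b c d) = cyc (σ ⟨$⟩ʳ a) (σ ⟨$⟩ʳ b) (σ ⟨$⟩ʳ c) (σ ⟨$⟩ʳ d)

applyS : Permutation′ 9 → List Cycle → List Cycle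
applyS σ = map (applyC σ)

-- Vertex labels 1..9 (anything else is never used).
v : ℕ → Vertex
v 1 = zero
v 2 = suc zero
v 3 = suc (suc zero)
v 4 = suc (suc (suc zero))
v 5 = suc (suc (suc (suc zero)))
v 6 = suc (suc (suc (suc (suc zero))))
v 7 = suc (suc (suc (suc (suc (suc zero)))))
v 8 = suc (suc (suc (suc (suc (suc (suc zero))))))
v 9 = suc (suc (suc (suc (suc (suc (suc (suc zero)))))))
v _ = zero

C : ℕ → ℕ → ℕ → ℕ → Cycle
C p q r t = cyc (v p) (v q) (v r) (v t)

S₁ S₂ S₃ S₄ S₅ S₆ S₇ S₈ : List Cycle
S₁ = C 1 2 3 4 ∷ C 1 3 5 6 ∷ C 1 5 2 7 ∷ C 1 8 2 9 ∷ C 2 4 7 6 ∷ C 3 6 4 8 ∷ C 3 7 5 9 ∷ C 4 5 8 9 ∷ C 6 8 7 9 ∷ []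
S₂ = C 1 2 3 4 ∷ C 1 3 5 6 ∷ C 1 5 2 7 ∷ C 1 8 2 9 ∷ C 2 4 7 6 ∷ C 3 6 8 7 ∷ C 3 8 4 9 ∷ C 4 5 9 6 ∷ C 5 7 9 8 ∷ []
S₃ = C 1 2 3 4 ∷ C 1 3 5 6 ∷ C 1 5 2 7 ∷ C 1 8 2 9 ∷ C 2 4 8 6 ∷ C 3 6 4 7 ∷ C 3 8 5 9 ∷ C 4 5 7 9 ∷ C 6 7 8 9 ∷ []
S₄ = C 1 2 3 4 ∷ C 1 3 5 6 ∷ C 1 5 2 7 ∷ C 1 8 2 9 ∷ C 2 4 8 6 ∷ C 3 6 4 7 ∷ C 3 8 7 9 ∷ C 4 5 8 9 ∷ C 5 7 6 9 ∷ []
S₅ = C 1 2 3 4 ∷ C 1 3 5 6 ∷ C 1 5 2 7 ∷ C 1 8 2 9 ∷ C 2 4 8 6 ∷ C 3 6 7 8 ∷ C 3 7 4 9 ∷ C 4 5 9 6 ∷ C 5 7 9 8 ∷ []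
S₆ = C 1 2 3 4 ∷ C 1 3 5 6 ∷ C 1 5 2 7 ∷ C 1 8 2 9 ∷ C 2 4 8 6 ∷ C 3 6 7 8 ∷ C 3 7 5 9 ∷ C 4 5 8 9 ∷ C 4 6 9 7 ∷ []
S₇ = C 1 2 3 4 ∷ C 1 3 5 6 ∷ C 1 5 2 7 ∷ C 1 8 2 9 ∷ C 2 4 8 6 ∷ C 3 6 9 8 ∷ C 3 7 4 9 ∷ C 4 5 7 6 ∷ C 5 8 7 9 ∷ []
S₈ = C 1 2 3 4 ∷ C 1 3 5 6 ∷ C 1 5 2 7 ∷ C 1 8 4 9 ∷ C 2 4 5 8 ∷ C 2 6 8 9 ∷ C 3 6 7 8 ∷ C 3 7 5 9 ∷ C 4 6 9 7 ∷ []

-- S i for i : Fin 8 is S_{i+1}.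
S : Fin 8 → List Cycle
S zero = S₁
S (suc zero) = S₂
S (suc (suc zero)) = S₃
S (suc (suc (suc zero))) = S₄
S (suc (suc (suc (suc zero)))) = S₅
S (suc (suc (suc (suc (suc zero))))) = S₆
S (suc (suc (suc (suc (suc (suc zero)))))) = S₇
S (suc (suc (suc (suc (suc (suc (suc zero))))))) = S₈

-- Every step of a path can be undone: exchanging T' back for T is again a bitrade step, because a
-- cycle of the system sharing an edge with T' shares it with T and so, the edge being covered once,
-- already lies in T.  Relabelling the vertices maps paths to paths.  It therefore suffices to join
-- each Sⱼ to S₁, and S₁ to S₁^σ for every σ.  The permutations π admitting a path from S₁ to S₁^π
-- are closed under composition; they contain the transpositions along a spanning tree of K₉,
-- hence, by conjugation, every transposition and so every permutation.  The finitely many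
-- explicit steps are verified by evaluating decision procedures.

module Submission where

open import Defs
open import Data.Nat as ℕ using (ℕ)
open import Data.Fin using (Fin; zero; suc; _≟_; cast)
open import Data.Fin.Patterns using (0F; 1F; 2F; 3F; 4F; 5F; 6F; 7F; 8F)
open import Data.Fin.Properties using (all?; any?; cast-involutive)
open import Data.Fin.Permutation
  using (Permutation′; _⟨$⟩ʳ_; _⟨$⟩ˡ_; inverseˡ; inverseʳ; id; flip; transpose; _∘ₚ_; _≈_)
open import Data.Fin.Permutation.Transposition.List using (eval; decompose; eval-decompose)
open import Data.List using (List; []; _∷_; length; lookup; map)
open import Data.List.Properties using (length-map; map-cong; map-∘; map-id)
open import Data.List.Relation.Unary.All as All using (All; []; _∷_)
import Data.List.Relation.Unary.All.Properties as Allₚ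
open import Data.List.Relation.Unary.Any as Any using (Any; here; there)
import Data.List.Relation.Unary.Any.Properties as Anyₚ
open import Data.Product using (Σ; _×_; _,_; proj₁; uncurry)
import Data.Product as Product
open import Data.Product.Function.NonDependent.Propositional using (_×-⇔_)
open import Data.Sum using (_⊎_; inj₁; inj₂)
import Data.Sum as Sum
open import Data.Sum.Function.Propositional using (_⊎-⇔_)
open import Data.Empty using (⊥-elim)
open import Function using (_∘_; _$_)
open import Function.Bundles using (_⇔_; mk⇔; Equivalence)
import Function.Properties.Equivalence as ⇔
open import Function.Related.TypeIsomorphisms using (¬-cong-⇔)
open import Relation.Nullary using (¬_; Dec; yes; no)
open import Relation.Nullary.Decidable
  using (True; toWitness; map′; _×-dec_; _⊎-dec_; _→-dec_; ¬?; dec-true; dec-false)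
open import Relation.Binary.PropositionalEquality
  using (_≡_; _≢_; refl; sym; trans; cong; subst; subst₂)

open Equivalence

private
  variable
    n : ℕ
    x y : Vertex
    X Y : Cycle
    A B D L T T' : List Cycle
    π ρ : Permutation′ 9

_⇔-dec_ : {P Q : Set} → Dec P → Dec Q → Dec (P ⇔ Q)
p? ⇔-dec q? = map′ (uncurry mk⇔) (λ e → to e , from e) ((p? →-dec q?) ×-dec (q? →-dec p?))

samePair? : ∀ x y u w → Dec (SamePair x y u w)
samePair? x y u w = ((x ≟ u) ×-dec (y ≟ w)) ⊎-dec ((x ≟ w) ×-dec (y ≟ u))

hasEdge? : ∀ X x y → Dec (HasEdge X x y)
hasEdge? (cyc p q r s) x y =
  samePair? x y p q ⊎-dec samePair? x y q r ⊎-dec samePair? x y r s ⊎-dec samePair? x y s p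

isCycle? : ∀ X → Dec (IsCycle X)
isCycle? (cyc p q r s) =
  ¬? (p ≟ q) ×-dec ¬? (p ≟ r) ×-dec ¬? (p ≟ s) ×-dec ¬? (q ≟ r) ×-dec ¬? (q ≟ s) ×-dec ¬? (r ≟ s)

sameCycle? : ∀ X Y → Dec (SameCycle X Y)
sameCycle? X Y = all? λ x → all? λ y → hasEdge? X x y ⇔-dec hasEdge? Y x y

_∈c?_ : ∀ X L → Dec (X ∈c L)
X ∈c? L = Any.any? (sameCycle? X) L

covers? : ∀ L x y → Dec (Covers L x y)
covers? L x y = Any.any? (λ X → hasEdge? X x y) L

pairwiseEdgeDisjoint? : ∀ L → Dec (PairwiseEdgeDisjoint L)
pairwiseEdgeDisjoint? L =
  all? λ i → all? λ j → ¬? (i ≟ j) →-dec all? λ x → all? λ y →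
    ¬? (hasEdge? (lookup L i) x y ×-dec hasEdge? (lookup L j) x y)

isSystem? : ∀ L → Dec (IsSystem L)
isSystem? L =
  All.all? isCycle? L ×-dec
  (all? λ x → all? λ y → ¬? (x ≟ y) →-dec any? λ i →
     hasEdge? (lookup L i) x y ×-dec all? λ j → hasEdge? (lookup L j) x y →-dec j ≟ i)

vol23? : ∀ s → Dec (Vol23 s)
vol23? s = (s ℕ.≟ 2) ⊎-dec (s ℕ.≟ 3)

sameCycle-refl : SameCycle X X
sameCycle-refl _ _ = ⇔.refl

sameCycle-sym : SameCycle X Y → SameCycle Y X
sameCycle-sym X~Y x y = ⇔.sym (X~Y x y)

sameCycle-trans : ∀ {X Y Z} → SameCycle X Y → SameCycle Y Z → SameCycle X Z
sameCycle-trans X~Y Y~Z x y = ⇔.trans (X~Y x y) (Y~Z x y)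

∈c-resp : SameCycle X Y → Y ∈c L → X ∈c L
∈c-resp X~Y = Any.map (sameCycle-trans X~Y)

All-lookup-∈c : {Q : Cycle → Set} → (∀ {Y Z} → SameCycle Y Z → Q Z → Q Y) → All Q L → X ∈c L → Q X
All-lookup-∈c resp all X∈L with All.lookupAny all X∈L
... | QY , X~Y = resp X~Y QY

⊆c-fromAll : All (_∈c B) A → A ⊆c B
⊆c-fromAll A⊆B _ = All-lookup-∈c ∈c-resp A⊆B

≈c-refl : A ≈c A
≈c-refl _ = ⇔.refl

≈c-sym : A ≈c B → B ≈c A
≈c-sym A≈B X = ⇔.sym (A≈B X)

≈c-trans : A ≈c B → B ≈c D → A ≈c D
≈c-trans A≈B B≈D X = ⇔.trans (A≈B X) (B≈D X)

∈c-covers : X ∈c L → HasEdge X x y → Covers L x y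
∈c-covers X∈L edge = Any.map (λ X~Y → to (X~Y _ _) edge) X∈L

covers-∈c : Covers L x y → Σ Cycle λ Y → Y ∈c L × HasEdge Y x y
covers-∈c (here edge) = _ , here sameCycle-refl , edge
covers-∈c (there c) = Product.map₂ (Product.map₁ there) (covers-∈c c)

∈c-properEdge : All IsCycle L → X ∈c L → Σ Vertex λ x → Σ Vertex λ y → x ≢ y × HasEdge X x y
∈c-properEdge cycles X∈L with All.lookupAny cycles X∈L
... | (p≢q , _) , X~Y = _ , _ , p≢q , from (X~Y (a (Any.lookup X∈L)) _) (inj₁ (inj₁ (refl , refl)))

system-sameCycle : IsSystem A → X ∈c A → Y ∈c A → x ≢ y → HasEdge X x y → HasEdge Y x y → SameCycle X Y
system-sameCycle {A} {x = x} {y} (_ , unique) X∈A Y∈A x≢y edgeX edgeY with unique x y x≢y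
... | _ , _ , only = sameCycle-trans (subst (λ k → SameCycle _ (lookup A k)) same-index X~Aᵢ) (sameCycle-sym Y~Aⱼ)
  where
  X~Aᵢ : SameCycle _ (lookup A (Any.index X∈A))
  X~Aᵢ = Anyₚ.lookup-index X∈A
  Y~Aⱼ : SameCycle _ (lookup A (Any.index Y∈A))
  Y~Aⱼ = Anyₚ.lookup-index Y∈A
  same-index : Any.index X∈A ≡ Any.index Y∈A
  same-index = trans (only _ (to (X~Aᵢ x y) edgeX)) (sym (only _ (to (Y~Aⱼ x y) edgeY)))

step-resp-≈c : A ≈c B → Step B D → Step A D
step-resp-≈c A≈B (s , vol , T , T' , bitrade , T⊆B , system , members) =
  s , vol , T , T' , bitrade , (λ X → from (A≈B X) ∘ T⊆B X) , system ,
  λ X → ⇔.trans (members X) ((≈c-sym A≈B X ×-⇔ ⇔.refl) ⊎-⇔ ⇔.refl)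

path-resp-≈c : A ≈c B → IsSystem A → Path B D → Path A D
path-resp-≈c A≈B system (done _ B≈D) = done system (≈c-trans A≈B B≈D)
path-resp-≈c A≈B system (step s p) = step (step-resp-≈c A≈B s) p

path-trans : Path A B → Path B D → Path A D
path-trans (done system A≈B) q = path-resp-≈c A≈B system q
path-trans (step s p) q = step s (path-trans p q)

∈c-trade-removed : IsSystem A → T ⊆c A → (∀ x y → Covers T' x y → Covers T x y) →
                   X ∈c A → X ∈c T' → X ∈c T
∈c-trade-removed system T⊆A T'⊆T X∈A X∈T' with ∈c-properEdge (proj₁ system) X∈A
... | x , y , x≢y , edge with covers-∈c (T'⊆T x y (∈c-covers X∈T' edge))
...   | Y , Y∈T , edgeY =
  ∈c-resp (system-sameCycle system X∈A (T⊆A Y Y∈T) x≢y edge edgeY) Y∈T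

step-sym : IsSystem A → Step A B → Step B A
step-sym {A} {B} systemA
         (s , vol , T , T' , (l , l' , cs , cs' , ds , ds' , T∩T'=∅ , covers) , T⊆A , _ , members) =
  s , vol , T' , T ,
  (l' , l , cs' , cs , ds' , ds , (λ X X∈T' X∈T → T∩T'=∅ X X∈T X∈T') , λ x y → ⇔.sym (covers x y)) ,
  (λ X X∈T' → from (members X) (inj₂ X∈T')) , systemA , λ X → mk⇔ (split X) (join X)
  where
  split : ∀ X → X ∈c A → (X ∈c B × ¬ X ∈c T') ⊎ X ∈c T
  split X X∈A with X ∈c? T
  ... | yes X∈T = inj₂ X∈T
  ... | no X∉T = inj₁ (from (members X) (inj₁ (X∈A , X∉T)) ,
                       X∉T ∘ ∈c-trade-removed systemA T⊆A (λ x y → from (covers x y)) X∈A)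
  join : ∀ X → (X ∈c B × ¬ X ∈c T') ⊎ X ∈c T → X ∈c A
  join X (inj₂ X∈T) = T⊆A X X∈T
  join X (inj₁ (X∈B , X∉T')) with to (members X) X∈B
  ... | inj₁ (X∈A , _) = X∈A
  ... | inj₂ X∈T' = ⊥-elim (X∉T' X∈T')

step-target-isSystem : Step A B → IsSystem B
step-target-isSystem (_ , _ , _ , _ , _ , _ , system , _) = system

path-sym : IsSystem A → IsSystem B → Path A B → Path B A
path-sym _ systemB (done _ A≈B) = done systemB (≈c-sym A≈B)
path-sym systemA systemB (step s p) =
  path-trans (path-sym (step-target-isSystem s) systemB p) (step (step-sym systemA s) (done systemA ≈c-refl))

members-fromAll : All (λ Y → (Y ∈c A × ¬ Y ∈c T) ⊎ Y ∈c T') B → All (λ Y → Y ∈c T ⊎ Y ∈c B) A →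
                  All (_∈c B) T' → X ∈c B ⇔ ((X ∈c A × ¬ X ∈c T) ⊎ X ∈c T')
members-fromAll {A} {T} {T'} {B} B⊆ A⊆ T'⊆B = mk⇔ (All-lookup-∈c resp B⊆) join
  where
  resp : ∀ {Y Z} → SameCycle Y Z → (Z ∈c A × ¬ Z ∈c T) ⊎ Z ∈c T' → (Y ∈c A × ¬ Y ∈c T) ⊎ Y ∈c T'
  resp Y~Z (inj₁ (Z∈A , Z∉T)) = inj₁ (∈c-resp Y~Z Z∈A , Z∉T ∘ ∈c-resp (sameCycle-sym Y~Z))
  resp Y~Z (inj₂ Z∈T') = inj₂ (∈c-resp Y~Z Z∈T')
  join : ∀ {X} → (X ∈c A × ¬ X ∈c T) ⊎ X ∈c T' → X ∈c B
  join (inj₁ (X∈A , X∉T)) with All-lookup-∈c (λ Y~Z → Sum.map (∈c-resp Y~Z) (∈c-resp Y~Z)) A⊆ X∈A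
  ... | inj₁ X∈T = ⊥-elim (X∉T X∈T)
  ... | inj₂ X∈B = X∈B
  join (inj₂ X∈T') = ⊆c-fromAll T'⊆B _ X∈T'

-- A decidable sufficient condition for Step A B: the quantifiers over arbitrary cycles in Step are
-- replaced by conditions on the listed cycles.
TradeEvidence : (A T T' B : List Cycle) → Set
TradeEvidence A T T' B =
  Vol23 (length T) × length T' ≡ length T ×
  All IsCycle T × All IsCycle T' ×
  PairwiseEdgeDisjoint T × PairwiseEdgeDisjoint T' ×
  All (λ Y → All (λ Z → ¬ SameCycle Y Z) T') T ×
  (∀ x y → Covers T x y ⇔ Covers T' x y) ×
  All (_∈c A) T ×
  IsSystem B ×
  All (λ Y → (Y ∈c A × ¬ Y ∈c T) ⊎ Y ∈c T') B ×
  All (λ Y → Y ∈c T ⊎ Y ∈c B) A ×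
  All (_∈c B) T'

tradeEvidence? : ∀ A T T' B → Dec (TradeEvidence A T T' B)
tradeEvidence? A T T' B =
  vol23? (length T) ×-dec length T' ℕ.≟ length T ×-dec
  All.all? isCycle? T ×-dec All.all? isCycle? T' ×-dec
  pairwiseEdgeDisjoint? T ×-dec pairwiseEdgeDisjoint? T' ×-dec
  All.all? (λ Y → All.all? (λ Z → ¬? (sameCycle? Y Z)) T') T ×-dec
  (all? λ x → all? λ y → covers? T x y ⇔-dec covers? T' x y) ×-dec
  All.all? (_∈c? A) T ×-dec
  isSystem? B ×-dec
  All.all? (λ Y → (Y ∈c? A ×-dec ¬? (Y ∈c? T)) ⊎-dec Y ∈c? T') B ×-dec
  All.all? (λ Y → Y ∈c? T ⊎-dec Y ∈c? B) A ×-dec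
  All.all? (_∈c? B) T'

trade-step : TradeEvidence A T T' B → Step A B
trade-step {T = T} {T'}
           (vol , length-T' , cycles , cycles' , disjoint , disjoint' , distinct , covers ,
            T⊆A , system , B⊆ , A⊆ , T'⊆B) =
  length T , vol , T , T' ,
  (refl , length-T' , cycles , cycles' , disjoint , disjoint' , T∩T'=∅ , covers) ,
  ⊆c-fromAll T⊆A , system , λ _ → members-fromAll B⊆ A⊆ T'⊆B
  where
  T∩T'=∅ : ∀ X → X ∈c T → ¬ X ∈c T'
  T∩T'=∅ X X∈T X∈T' with All.lookupAny distinct X∈T
  ... | Y≁T' , X~Y with All.lookupAny Y≁T' X∈T'
  ...   | Y≁Z , X~Z = Y≁Z (sameCycle-trans (sameCycle-sym X~Y) X~Z)

trade : ∀ {A D} T T' B → {True (tradeEvidence? A T T' B)} → Path B D → Path A D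
trade T T' B {evidence} = step (trade-step (toWitness evidence))

finish : ∀ {A} → {evidence : True (isSystem? A)} → Path A A
finish {evidence = evidence} = done (toWitness evidence) ≈c-refl

lookup-map : ∀ {A B : Set} (f : A → B) (xs : List A) i →
             lookup (map f xs) i ≡ f (lookup xs (cast (length-map f xs) i))
lookup-map f (x ∷ xs) zero = refl
lookup-map f (x ∷ xs) (suc i) = lookup-map f xs i

⟨$⟩ʳ-injective : ∀ (σ : Permutation′ n) {i j} → σ ⟨$⟩ʳ i ≡ σ ⟨$⟩ʳ j → i ≡ j
⟨$⟩ʳ-injective σ eq = trans (sym (inverseˡ σ)) (trans (cong (σ ⟨$⟩ˡ_) eq) (inverseˡ σ))

⟨$⟩ˡ-injective : ∀ (σ : Permutation′ n) {i j} → σ ⟨$⟩ˡ i ≡ σ ⟨$⟩ˡ j → i ≡ j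
⟨$⟩ˡ-injective σ = ⟨$⟩ʳ-injective (flip σ)

applyC-inverseˡ : ∀ σ X → applyC (flip σ) (applyC σ X) ≡ X
applyC-inverseˡ σ (cyc p q r s)
  rewrite inverseˡ σ {p} | inverseˡ σ {q} | inverseˡ σ {r} | inverseˡ σ {s} = refl

applyC-inverseʳ : ∀ σ X → applyC σ (applyC (flip σ) X) ≡ X
applyC-inverseʳ σ = applyC-inverseˡ (flip σ)

hasEdge-relabel : ∀ σ X → HasEdge X x y → HasEdge (applyC σ X) (σ ⟨$⟩ʳ x) (σ ⟨$⟩ʳ y)
hasEdge-relabel σ _ = Sum.map samePair (Sum.map samePair (Sum.map samePair samePair))
  where
  samePair : ∀ {x y u w} → SamePair x y u w → SamePair (σ ⟨$⟩ʳ x) (σ ⟨$⟩ʳ y) (σ ⟨$⟩ʳ u) (σ ⟨$⟩ʳ w)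
  samePair = Sum.map (Product.map (cong (σ ⟨$⟩ʳ_)) (cong (σ ⟨$⟩ʳ_)))
                     (Product.map (cong (σ ⟨$⟩ʳ_)) (cong (σ ⟨$⟩ʳ_)))

hasEdge-relabel-⇔ : ∀ σ → HasEdge (applyC σ X) x y ⇔ HasEdge X (σ ⟨$⟩ˡ x) (σ ⟨$⟩ˡ y)
hasEdge-relabel-⇔ {X} σ = mk⇔
  (subst (λ Z → HasEdge Z _ _) (applyC-inverseˡ σ X) ∘ hasEdge-relabel (flip σ) (applyC σ X))
  (subst₂ (HasEdge (applyC σ X)) (inverseʳ σ) (inverseʳ σ) ∘ hasEdge-relabel σ X)

sameCycle-relabel : ∀ σ → SameCycle X Y → SameCycle (applyC σ X) (applyC σ Y)
sameCycle-relabel σ X~Y x y =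
  ⇔.trans (hasEdge-relabel-⇔ σ) (⇔.trans (X~Y _ _) (⇔.sym (hasEdge-relabel-⇔ σ)))

∈c-relabel-⇔ : ∀ σ → X ∈c applyS σ L ⇔ applyC (flip σ) X ∈c L
∈c-relabel-⇔ {X} σ = mk⇔
  (Any.map (λ X~σY → subst (SameCycle _) (applyC-inverseˡ σ _) (sameCycle-relabel (flip σ) X~σY))
     ∘ Anyₚ.map⁻)
  (Anyₚ.map⁺
     ∘ Any.map (λ σ⁻¹X~Y → subst (λ Z → SameCycle Z _) (applyC-inverseʳ σ X) (sameCycle-relabel σ σ⁻¹X~Y)))

covers-relabel-⇔ : ∀ σ → Covers (applyS σ L) x y ⇔ Covers L (σ ⟨$⟩ˡ x) (σ ⟨$⟩ˡ y)
covers-relabel-⇔ σ =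
  mk⇔ (Any.map (to (hasEdge-relabel-⇔ σ)) ∘ Anyₚ.map⁻)
      (Anyₚ.map⁺ ∘ Any.map (from (hasEdge-relabel-⇔ σ)))

hasEdge-lookup-relabel-⇔ : ∀ σ L i →
  HasEdge (lookup (applyS σ L) i) x y ⇔
  HasEdge (lookup L (cast (length-map (applyC σ) L) i)) (σ ⟨$⟩ˡ x) (σ ⟨$⟩ˡ y)
hasEdge-lookup-relabel-⇔ σ L i rewrite lookup-map (applyC σ) L i = hasEdge-relabel-⇔ σ

isCycle-relabel : ∀ σ X → IsCycle X → IsCycle (applyC σ X)
isCycle-relabel σ _ (pq , pr , ps , qr , qs , rs) = inj pq , inj pr , inj ps , inj qr , inj qs , inj rs
  where
  inj : ∀ {i j} → i ≢ j → σ ⟨$⟩ʳ i ≢ σ ⟨$⟩ʳ j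
  inj i≢j = i≢j ∘ ⟨$⟩ʳ-injective σ

allIsCycle-relabel : ∀ σ → All IsCycle L → All IsCycle (applyS σ L)
allIsCycle-relabel σ = Allₚ.map⁺ ∘ All.map (isCycle-relabel σ _)

pairwiseEdgeDisjoint-relabel : ∀ σ → PairwiseEdgeDisjoint L → PairwiseEdgeDisjoint (applyS σ L)
pairwiseEdgeDisjoint-relabel {L} σ disjoint i j i≢j x y (edge-i , edge-j) =
  disjoint (cast eq i) (cast eq j) (i≢j ∘ cast-injective) _ _
    (to (hasEdge-lookup-relabel-⇔ σ L i) edge-i , to (hasEdge-lookup-relabel-⇔ σ L j) edge-j)
  where
  eq : length (applyS σ L) ≡ length L
  eq = length-map (applyC σ) L
  cast-injective : cast eq i ≡ cast eq j → i ≡ j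
  cast-injective e =
    trans (sym (cast-involutive (sym eq) eq i)) (trans (cong (cast (sym eq)) e) (cast-involutive (sym eq) eq j))

isSystem-relabel : ∀ σ → IsSystem L → IsSystem (applyS σ L)
isSystem-relabel {L} σ (cycles , unique) = allIsCycle-relabel σ cycles , covered
  where
  eq : length (applyS σ L) ≡ length L
  eq = length-map (applyC σ) L
  covered : ∀ x y → x ≢ y → Σ (Fin (length (applyS σ L))) λ i →
              HasEdge (lookup (applyS σ L) i) x y × (∀ j → HasEdge (lookup (applyS σ L) j) x y → j ≡ i)
  covered x y x≢y with unique (σ ⟨$⟩ˡ x) (σ ⟨$⟩ˡ y) (x≢y ∘ ⟨$⟩ˡ-injective σ)
  ... | k , edge-k , only-k =
    cast (sym eq) k ,
    from (hasEdge-lookup-relabel-⇔ σ L _)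
         (subst (λ i → HasEdge (lookup L i) _ _) (sym (cast-involutive eq (sym eq) k)) edge-k) ,
    λ j edge-j → trans (sym (cast-involutive (sym eq) eq j))
                       (cong (cast (sym eq)) (only-k _ (to (hasEdge-lookup-relabel-⇔ σ L j) edge-j)))

⊆c-relabel : ∀ σ → T ⊆c A → applyS σ T ⊆c applyS σ A
⊆c-relabel σ T⊆A X = from (∈c-relabel-⇔ σ) ∘ T⊆A _ ∘ to (∈c-relabel-⇔ σ)

≈c-relabel : ∀ σ → A ≈c B → applyS σ A ≈c applyS σ B
≈c-relabel σ A≈B X = ⇔.trans (∈c-relabel-⇔ σ) (⇔.trans (A≈B _) (⇔.sym (∈c-relabel-⇔ σ)))

isBitrade-relabel : ∀ σ {s} → IsBitrade s T T' → IsBitrade s (applyS σ T) (applyS σ T')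
isBitrade-relabel {T} {T'} σ (l , l' , cs , cs' , ds , ds' , T∩T'=∅ , covers) =
  trans (length-map _ T) l , trans (length-map _ T') l' ,
  allIsCycle-relabel σ cs , allIsCycle-relabel σ cs' ,
  pairwiseEdgeDisjoint-relabel {T} σ ds , pairwiseEdgeDisjoint-relabel {T'} σ ds' ,
  (λ X X∈T X∈T' → T∩T'=∅ _ (to (∈c-relabel-⇔ σ) X∈T) (to (∈c-relabel-⇔ σ) X∈T')) ,
  λ x y → ⇔.trans (covers-relabel-⇔ σ) (⇔.trans (covers _ _) (⇔.sym (covers-relabel-⇔ σ)))

step-relabel : ∀ σ → Step A B → Step (applyS σ A) (applyS σ B)
step-relabel σ (s , vol , T , T' , bitrade , T⊆A , system , members) =
  s , vol , applyS σ T , applyS σ T' , isBitrade-relabel σ bitrade ,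
  ⊆c-relabel σ T⊆A , isSystem-relabel σ system ,
  λ X → ⇔.trans (∈c-relabel-⇔ σ)
          (⇔.trans (members _)
            (⇔.sym ((∈c-relabel-⇔ σ ×-⇔ ¬-cong-⇔ (∈c-relabel-⇔ σ)) ⊎-⇔ ∈c-relabel-⇔ σ)))

path-relabel : ∀ σ → Path A B → Path (applyS σ A) (applyS σ B)
path-relabel σ (done system A≈B) = done (isSystem-relabel σ system) (≈c-relabel σ A≈B)
path-relabel σ (step s p) = step (step-relabel σ s) (path-relabel σ p)

transpose-ˡ : ∀ (i j : Fin n) {x} → x ≡ i → transpose i j ⟨$⟩ʳ x ≡ j
transpose-ˡ i j refl rewrite dec-true (i ≟ i) refl = refl

transpose-ʳ : ∀ (i j : Fin n) {x} → x ≡ j → transpose i j ⟨$⟩ʳ x ≡ i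
transpose-ʳ i j refl with j ≟ i
... | yes j≡i = j≡i
... | no _ rewrite dec-true (j ≟ j) refl = refl

transpose-fix : ∀ (i j : Fin n) {x} → x ≢ i → x ≢ j → transpose i j ⟨$⟩ʳ x ≡ x
transpose-fix i j {x} x≢i x≢j rewrite dec-false (x ≟ i) x≢i | dec-false (x ≟ j) x≢j = refl

-- The case splits go through an auxiliary function: `with x ≟ i` would also abstract the very
-- test that transpose performs, leaving the lemmas above inapplicable.
transpose-self : ∀ (i : Fin n) → transpose i i ≈ id
transpose-self i x = cases (x ≟ i)
  where
  cases : Dec (x ≡ i) → transpose i i ⟨$⟩ʳ x ≡ x
  cases (yes x≡i) = trans (transpose-ˡ i i x≡i) (sym x≡i)
  cases (no x≢i) = transpose-fix i i x≢i x≢i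

transpose-sym : ∀ (i j : Fin n) → transpose i j ≈ transpose j i
transpose-sym i j x = cases (x ≟ i) (x ≟ j)
  where
  cases : Dec (x ≡ i) → Dec (x ≡ j) → transpose i j ⟨$⟩ʳ x ≡ transpose j i ⟨$⟩ʳ x
  cases (yes x≡i) _ = trans (transpose-ˡ i j x≡i) (sym (transpose-ʳ j i x≡i))
  cases (no _) (yes x≡j) = trans (transpose-ʳ i j x≡j) (sym (transpose-ˡ j i x≡j))
  cases (no x≢i) (no x≢j) = trans (transpose-fix i j x≢i x≢j) (sym (transpose-fix j i x≢j x≢i))

transpose-conjugate : ∀ {i j k : Fin n} → i ≢ j → j ≢ k → i ≢ k →
                      transpose i j ∘ₚ transpose j k ∘ₚ transpose i j ≈ transpose i k
transpose-conjugate {i = i} {j} {k} i≢j j≢k i≢k x = cases (x ≟ i) (x ≟ j) (x ≟ k)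
  where
  conj : ∀ {p q r} → transpose i j ⟨$⟩ʳ x ≡ p → transpose j k ⟨$⟩ʳ p ≡ q → transpose i j ⟨$⟩ʳ q ≡ r →
         transpose i k ⟨$⟩ʳ x ≡ r →
         transpose i j ∘ₚ transpose j k ∘ₚ transpose i j ⟨$⟩ʳ x ≡ transpose i k ⟨$⟩ʳ x
  conj refl refl refl ik≡r = sym ik≡r
  cases : Dec (x ≡ i) → Dec (x ≡ j) → Dec (x ≡ k) →
          transpose i j ∘ₚ transpose j k ∘ₚ transpose i j ⟨$⟩ʳ x ≡ transpose i k ⟨$⟩ʳ x
  cases (yes x≡i) _ _ =
    conj (transpose-ˡ i j x≡i) (transpose-ˡ j k refl)
         (transpose-fix i j (i≢k ∘ sym) (j≢k ∘ sym)) (transpose-ˡ i k x≡i)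
  cases (no x≢i) (yes x≡j) _ =
    conj (transpose-ʳ i j x≡j) (transpose-fix j k i≢j i≢k)
         (transpose-ˡ i j refl) (trans (transpose-fix i k x≢i (j≢k ∘ trans (sym x≡j))) x≡j)
  cases (no x≢i) (no x≢j) (yes x≡k) =
    conj (transpose-fix i j x≢i x≢j) (transpose-ʳ j k x≡k) (transpose-ʳ i j refl) (transpose-ʳ i k x≡k)
  cases (no x≢i) (no x≢j) (no x≢k) =
    conj (transpose-fix i j x≢i x≢j) (transpose-fix j k x≢j x≢k)
         (transpose-fix i j x≢i x≢j) (transpose-fix i k x≢i x≢k)

record PathToImage (A : List Cycle) (π : Permutation′ 9) : Set where
  constructor pathToImage
  field path : Path A (applyS π A)
open PathToImage

applyC-cong : ∀ {π ρ} → π ≈ ρ → ∀ X → applyC π X ≡ applyC ρ X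
applyC-cong π≈ρ (cyc p q r s) rewrite π≈ρ p | π≈ρ q | π≈ρ r | π≈ρ s = refl

pathToImage-cong : ∀ {A π ρ} → π ≈ ρ → PathToImage A π → PathToImage A ρ
pathToImage-cong {A} {π} {ρ} π≈ρ (pathToImage p) =
  pathToImage (subst (Path A) (map-cong (applyC-cong {π} {ρ} π≈ρ) A) p)

pathToImage-id : IsSystem A → PathToImage A id
pathToImage-id {A} system = pathToImage (subst (Path A) (sym (map-id A)) (done system ≈c-refl))

pathToImage-∘ : PathToImage A π → PathToImage A ρ → PathToImage A (π ∘ₚ ρ)
pathToImage-∘ {A} {ρ = ρ} (pathToImage p) (pathToImage q) =
  pathToImage (subst (Path A) (sym (map-∘ A)) (path-trans q (path-relabel ρ p)))

pathToImage-all : IsSystem A → (∀ i j → PathToImage A (transpose i j)) → ∀ π → PathToImage A π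
pathToImage-all {A} system transpositions π = pathToImage-cong (eval-decompose π) (evaluated (decompose π))
  where
  evaluated : ∀ xs → PathToImage A (eval xs)
  evaluated [] = pathToImage-id system
  evaluated ((i , j) ∷ xs) = pathToImage-∘ (transpositions i j) (evaluated xs)

pathToImage-transpose-trans : ∀ {i j k} → i ≢ j → j ≢ k → i ≢ k →
  PathToImage A (transpose i j) → PathToImage A (transpose j k) → PathToImage A (transpose i k)
pathToImage-transpose-trans i≢j j≢k i≢k p q =
  pathToImage-cong (transpose-conjugate i≢j j≢k i≢k) (pathToImage-∘ p (pathToImage-∘ q p))

pathToImage-transpositions : ∀ r → IsSystem A → (∀ i → r ≢ i → PathToImage A (transpose r i)) →
                             ∀ i j → PathToImage A (transpose i j)
pathToImage-transpositions r system star i j with i ≟ j | i ≟ r | j ≟ r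
... | yes refl | _ | _ = pathToImage-cong (λ x → sym (transpose-self i x)) (pathToImage-id system)
... | no i≢j | yes refl | _ = star j i≢j
... | no i≢j | no _ | yes refl = pathToImage-cong (transpose-sym j i) (star i (i≢j ∘ sym))
... | no i≢j | no i≢r | no j≢r =
  pathToImage-transpose-trans i≢r (j≢r ∘ sym) i≢j
    (pathToImage-cong (transpose-sym r i) (star i (i≢r ∘ sym))) (star j (j≢r ∘ sym))

S-isSystem : ∀ j → IsSystem (S j)
S-isSystem = toWitness {a? = all? (λ j → isSystem? (S j))} _

toS₁ : ∀ j → Path (S j) S₁
toS₁ zero = finish
toS₁ (suc zero) =
  trade (C 3 6 8 7 ∷ C 4 5 9 6 ∷ C 5 7 9 8 ∷ [])
        (C 3 6 9 7 ∷ C 4 5 8 6 ∷ C 5 7 8 9 ∷ [])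
        (C 1 2 3 4 ∷ C 1 3 5 6 ∷ C 1 5 2 7 ∷ C 1 8 2 9 ∷ C 2 4 7 6 ∷ C 3 6 9 7 ∷ C 3 8 4 9 ∷ C 4 5 8 6 ∷ C 5 7 8 9 ∷ []) $
  trade (C 3 6 9 7 ∷ C 3 8 4 9 ∷ C 5 7 8 9 ∷ [])
        (C 3 6 9 8 ∷ C 3 7 5 9 ∷ C 4 8 7 9 ∷ [])
        (C 1 2 3 4 ∷ C 1 3 5 6 ∷ C 1 5 2 7 ∷ C 1 8 2 9 ∷ C 2 4 7 6 ∷ C 3 6 9 8 ∷ C 3 7 5 9 ∷ C 4 5 8 6 ∷ C 4 8 7 9 ∷ []) $
  trade (C 3 6 9 8 ∷ C 4 5 8 6 ∷ C 4 8 7 9 ∷ [])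
        (C 3 6 4 8 ∷ C 4 5 8 9 ∷ C 6 8 7 9 ∷ [])
        _ finish

toS₁ (suc (suc zero)) =
  trade (C 2 4 8 6 ∷ C 4 5 7 9 ∷ C 6 7 8 9 ∷ [])
        (C 2 4 9 6 ∷ C 4 5 7 8 ∷ C 6 7 9 8 ∷ [])
        (C 1 2 3 4 ∷ C 1 3 5 6 ∷ C 1 5 2 7 ∷ C 1 8 2 9 ∷ C 2 4 9 6 ∷ C 3 6 4 7 ∷ C 3 8 5 9 ∷ C 4 5 7 8 ∷ C 6 7 9 8 ∷ []) $
  trade (C 3 6 4 7 ∷ C 3 8 5 9 ∷ C 4 5 7 8 ∷ [])
        (C 3 6 4 8 ∷ C 3 7 5 9 ∷ C 4 5 8 7 ∷ [])
        (C 1 2 3 4 ∷ C 1 3 5 6 ∷ C 1 5 2 7 ∷ C 1 8 2 9 ∷ C 2 4 9 6 ∷ C 3 6 4 8 ∷ C 3 7 5 9 ∷ C 4 5 8 7 ∷ C 6 7 9 8 ∷ []) $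
  trade (C 2 4 9 6 ∷ C 4 5 8 7 ∷ C 6 7 9 8 ∷ [])
        (C 2 4 7 6 ∷ C 4 5 8 9 ∷ C 6 8 7 9 ∷ [])
        _ finish

toS₁ (suc (suc (suc zero))) =
  trade (C 3 6 4 7 ∷ C 3 8 7 9 ∷ C 5 7 6 9 ∷ [])
        (C 3 6 7 8 ∷ C 3 7 5 9 ∷ C 4 6 9 7 ∷ [])
        (C 1 2 3 4 ∷ C 1 3 5 6 ∷ C 1 5 2 7 ∷ C 1 8 2 9 ∷ C 2 4 8 6 ∷ C 3 6 7 8 ∷ C 3 7 5 9 ∷ C 4 5 8 9 ∷ C 4 6 9 7 ∷ []) $
  trade (C 2 4 8 6 ∷ C 3 6 7 8 ∷ C 4 6 9 7 ∷ [])
        (C 2 4 7 6 ∷ C 3 6 4 8 ∷ C 6 8 7 9 ∷ [])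
        _ finish

toS₁ (suc (suc (suc (suc zero)))) =
  trade (C 3 7 4 9 ∷ C 4 5 9 6 ∷ C 5 7 9 8 ∷ [])
        (C 3 7 5 9 ∷ C 4 5 8 9 ∷ C 4 6 9 7 ∷ [])
        (C 1 2 3 4 ∷ C 1 3 5 6 ∷ C 1 5 2 7 ∷ C 1 8 2 9 ∷ C 2 4 8 6 ∷ C 3 6 7 8 ∷ C 3 7 5 9 ∷ C 4 5 8 9 ∷ C 4 6 9 7 ∷ []) $
  trade (C 2 4 8 6 ∷ C 3 6 7 8 ∷ C 4 6 9 7 ∷ [])
        (C 2 4 7 6 ∷ C 3 6 4 8 ∷ C 6 8 7 9 ∷ [])
        _ finish

toS₁ (suc (suc (suc (suc (suc zero))))) =
  trade (C 2 4 8 6 ∷ C 3 6 7 8 ∷ C 4 6 9 7 ∷ [])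
        (C 2 4 7 6 ∷ C 3 6 4 8 ∷ C 6 8 7 9 ∷ [])
        _ finish

toS₁ (suc (suc (suc (suc (suc (suc zero)))))) =
  trade (C 3 6 9 8 ∷ C 4 5 7 6 ∷ C 5 8 7 9 ∷ [])
        (C 3 6 7 8 ∷ C 4 5 9 6 ∷ C 5 7 9 8 ∷ [])
        (C 1 2 3 4 ∷ C 1 3 5 6 ∷ C 1 5 2 7 ∷ C 1 8 2 9 ∷ C 2 4 8 6 ∷ C 3 6 7 8 ∷ C 3 7 4 9 ∷ C 4 5 9 6 ∷ C 5 7 9 8 ∷ []) $
  trade (C 3 7 4 9 ∷ C 4 5 9 6 ∷ C 5 7 9 8 ∷ [])
        (C 3 7 5 9 ∷ C 4 5 8 9 ∷ C 4 6 9 7 ∷ [])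
        (C 1 2 3 4 ∷ C 1 3 5 6 ∷ C 1 5 2 7 ∷ C 1 8 2 9 ∷ C 2 4 8 6 ∷ C 3 6 7 8 ∷ C 3 7 5 9 ∷ C 4 5 8 9 ∷ C 4 6 9 7 ∷ []) $
  trade (C 2 4 8 6 ∷ C 3 6 7 8 ∷ C 4 6 9 7 ∷ [])
        (C 2 4 7 6 ∷ C 3 6 4 8 ∷ C 6 8 7 9 ∷ [])
        _ finish

toS₁ (suc (suc (suc (suc (suc (suc (suc zero))))))) =
  trade (C 1 8 4 9 ∷ C 2 4 5 8 ∷ C 2 6 8 9 ∷ [])
        (C 1 8 2 9 ∷ C 2 4 8 6 ∷ C 4 5 8 9 ∷ [])
        (C 1 2 3 4 ∷ C 1 3 5 6 ∷ C 1 5 2 7 ∷ C 1 8 2 9 ∷ C 2 4 8 6 ∷ C 3 6 7 8 ∷ C 3 7 5 9 ∷ C 4 5 8 9 ∷ C 4 6 9 7 ∷ []) $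
  trade (C 2 4 8 6 ∷ C 3 6 7 8 ∷ C 4 6 9 7 ∷ [])
        (C 2 4 7 6 ∷ C 3 6 4 8 ∷ C 6 8 7 9 ∷ [])
        _ finish

S₁-swap-1-2 : PathToImage S₁ (transpose (v 1) (v 2))
S₁-swap-1-2 = pathToImage $
  trade (C 1 2 3 4 ∷ C 1 3 5 6 ∷ C 2 4 7 6 ∷ [])
        (C 1 2 4 3 ∷ C 1 4 7 6 ∷ C 2 3 5 6 ∷ [])
        _ finish

S₁-swap-1-3 : PathToImage S₁ (transpose (v 1) (v 3))
S₁-swap-1-3 = pathToImage $
  trade (C 1 5 2 7 ∷ C 1 8 2 9 ∷ [])
        (C 1 5 2 8 ∷ C 1 7 2 9 ∷ [])
        (C 1 2 3 4 ∷ C 1 3 5 6 ∷ C 1 5 2 8 ∷ C 1 7 2 9 ∷ C 2 4 7 6 ∷ C 3 6 4 8 ∷ C 3 7 5 9 ∷ C 4 5 8 9 ∷ C 6 8 7 9 ∷ []) $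
  trade (C 1 3 5 6 ∷ C 1 5 2 8 ∷ C 3 6 4 8 ∷ [])
        (C 1 3 6 5 ∷ C 1 6 4 8 ∷ C 2 5 3 8 ∷ [])
        (C 1 2 3 4 ∷ C 1 3 6 5 ∷ C 1 6 4 8 ∷ C 1 7 2 9 ∷ C 2 4 7 6 ∷ C 2 5 3 8 ∷ C 3 7 5 9 ∷ C 4 5 8 9 ∷ C 6 8 7 9 ∷ []) $
  trade (C 1 7 2 9 ∷ C 2 5 3 8 ∷ C 3 7 5 9 ∷ [])
        (C 1 7 5 9 ∷ C 2 5 3 7 ∷ C 2 8 3 9 ∷ [])
        _ finish

S₁-swap-2-7 : PathToImage S₁ (transpose (v 2) (v 7))
S₁-swap-2-7 = pathToImage $
  trade (C 1 2 3 4 ∷ C 1 5 2 7 ∷ C 3 7 5 9 ∷ [])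
        (C 1 2 7 5 ∷ C 1 4 3 7 ∷ C 2 3 9 5 ∷ [])
        (C 1 2 7 5 ∷ C 1 3 5 6 ∷ C 1 4 3 7 ∷ C 1 8 2 9 ∷ C 2 3 9 5 ∷ C 2 4 7 6 ∷ C 3 6 4 8 ∷ C 4 5 8 9 ∷ C 6 8 7 9 ∷ []) $
  trade (C 1 8 2 9 ∷ C 6 8 7 9 ∷ [])
        (C 1 8 7 9 ∷ C 2 8 6 9 ∷ [])
        _ finish

S₁-swap-7-9 : PathToImage S₁ (transpose (v 7) (v 9))
S₁-swap-7-9 = pathToImage $
  trade (C 2 4 7 6 ∷ C 4 5 8 9 ∷ C 6 8 7 9 ∷ [])
        (C 2 4 9 6 ∷ C 4 5 8 7 ∷ C 6 7 9 8 ∷ [])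
        (C 1 2 3 4 ∷ C 1 3 5 6 ∷ C 1 5 2 7 ∷ C 1 8 2 9 ∷ C 2 4 9 6 ∷ C 3 6 4 8 ∷ C 3 7 5 9 ∷ C 4 5 8 7 ∷ C 6 7 9 8 ∷ []) $
  trade (C 1 5 2 7 ∷ C 1 8 2 9 ∷ [])
        (C 1 5 2 9 ∷ C 1 7 2 8 ∷ [])
        _ finish

S₁-swap-9-8 : PathToImage S₁ (transpose (v 9) (v 8))
S₁-swap-9-8 = pathToImage $
  trade (C 3 6 4 8 ∷ C 3 7 5 9 ∷ C 4 5 8 9 ∷ [])
        (C 3 6 4 9 ∷ C 3 7 5 8 ∷ C 4 5 9 8 ∷ [])
        _ finish

S₁-swap-9-5 : PathToImage S₁ (transpose (v 9) (v 5))
S₁-swap-9-5 = pathToImage $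
  trade (C 1 3 5 6 ∷ C 3 7 5 9 ∷ C 6 8 7 9 ∷ [])
        (C 1 3 9 6 ∷ C 3 5 9 7 ∷ C 5 6 8 7 ∷ [])
        (C 1 2 3 4 ∷ C 1 3 9 6 ∷ C 1 5 2 7 ∷ C 1 8 2 9 ∷ C 2 4 7 6 ∷ C 3 5 9 7 ∷ C 3 6 4 8 ∷ C 4 5 8 9 ∷ C 5 6 8 7 ∷ []) $
  trade (C 1 5 2 7 ∷ C 1 8 2 9 ∷ [])
        (C 1 5 2 8 ∷ C 1 7 2 9 ∷ [])
        _ finish

S₁-swap-3-6 : PathToImage S₁ (transpose (v 3) (v 6))
S₁-swap-3-6 = pathToImage $
  trade (C 2 4 7 6 ∷ C 3 6 4 8 ∷ C 6 8 7 9 ∷ [])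
        (C 2 4 8 6 ∷ C 3 6 7 8 ∷ C 4 6 9 7 ∷ [])
        (C 1 2 3 4 ∷ C 1 3 5 6 ∷ C 1 5 2 7 ∷ C 1 8 2 9 ∷ C 2 4 8 6 ∷ C 3 6 7 8 ∷ C 3 7 5 9 ∷ C 4 5 8 9 ∷ C 4 6 9 7 ∷ []) $
  trade (C 3 6 7 8 ∷ C 3 7 5 9 ∷ C 4 6 9 7 ∷ [])
        (C 3 6 4 7 ∷ C 3 8 7 9 ∷ C 5 7 6 9 ∷ [])
        (C 1 2 3 4 ∷ C 1 3 5 6 ∷ C 1 5 2 7 ∷ C 1 8 2 9 ∷ C 2 4 8 6 ∷ C 3 6 4 7 ∷ C 3 8 7 9 ∷ C 4 5 8 9 ∷ C 5 7 6 9 ∷ []) $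
  trade (C 1 2 3 4 ∷ C 2 4 8 6 ∷ C 3 6 4 7 ∷ [])
        (C 1 2 6 4 ∷ C 2 3 7 4 ∷ C 3 4 8 6 ∷ [])
        _ finish

S₁-swap-6-4 : PathToImage S₁ (transpose (v 6) (v 4))
S₁-swap-6-4 = pathToImage $
  trade (C 3 6 4 8 ∷ C 4 5 8 9 ∷ C 6 8 7 9 ∷ [])
        (C 3 6 9 8 ∷ C 4 5 8 6 ∷ C 4 8 7 9 ∷ [])
        (C 1 2 3 4 ∷ C 1 3 5 6 ∷ C 1 5 2 7 ∷ C 1 8 2 9 ∷ C 2 4 7 6 ∷ C 3 6 9 8 ∷ C 3 7 5 9 ∷ C 4 5 8 6 ∷ C 4 8 7 9 ∷ []) $
  trade (C 1 3 5 6 ∷ C 3 6 9 8 ∷ C 4 5 8 6 ∷ [])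
        (C 1 3 8 6 ∷ C 3 5 4 6 ∷ C 5 6 9 8 ∷ [])
        (C 1 2 3 4 ∷ C 1 3 8 6 ∷ C 1 5 2 7 ∷ C 1 8 2 9 ∷ C 2 4 7 6 ∷ C 3 5 4 6 ∷ C 3 7 5 9 ∷ C 4 8 7 9 ∷ C 5 6 9 8 ∷ []) $
  trade (C 1 2 3 4 ∷ C 1 3 8 6 ∷ C 3 5 4 6 ∷ [])
        (C 1 2 3 6 ∷ C 1 3 5 4 ∷ C 3 4 6 8 ∷ [])
        _ finish

-- The eight explicit swaps are the edges of a spanning tree of K₉; conjugating along the tree gives
-- the swap of 1 with every other vertex.
S₁-swap-1-6 : PathToImage S₁ (transpose (v 1) (v 6))
S₁-swap-1-6 = pathToImage-transpose-trans (λ ()) (λ ()) (λ ()) S₁-swap-1-3 S₁-swap-3-6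

S₁-swap-1-4 : PathToImage S₁ (transpose (v 1) (v 4))
S₁-swap-1-4 = pathToImage-transpose-trans (λ ()) (λ ()) (λ ()) S₁-swap-1-6 S₁-swap-6-4

S₁-swap-1-7 : PathToImage S₁ (transpose (v 1) (v 7))
S₁-swap-1-7 = pathToImage-transpose-trans (λ ()) (λ ()) (λ ()) S₁-swap-1-2 S₁-swap-2-7

S₁-swap-1-9 : PathToImage S₁ (transpose (v 1) (v 9))
S₁-swap-1-9 = pathToImage-transpose-trans (λ ()) (λ ()) (λ ()) S₁-swap-1-7 S₁-swap-7-9

S₁-swap-1-8 : PathToImage S₁ (transpose (v 1) (v 8))
S₁-swap-1-8 = pathToImage-transpose-trans (λ ()) (λ ()) (λ ()) S₁-swap-1-9 S₁-swap-9-8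

S₁-swap-1-5 : PathToImage S₁ (transpose (v 1) (v 5))
S₁-swap-1-5 = pathToImage-transpose-trans (λ ()) (λ ()) (λ ()) S₁-swap-1-9 S₁-swap-9-5

S₁-star : ∀ i → v 1 ≢ i → PathToImage S₁ (transpose (v 1) i)
S₁-star 0F 1≢1 = ⊥-elim (1≢1 refl)
S₁-star 1F _ = S₁-swap-1-2
S₁-star 2F _ = S₁-swap-1-3
S₁-star 3F _ = S₁-swap-1-4
S₁-star 4F _ = S₁-swap-1-5
S₁-star 5F _ = S₁-swap-1-6
S₁-star 6F _ = S₁-swap-1-7
S₁-star 7F _ = S₁-swap-1-8
S₁-star 8F _ = S₁-swap-1-9

mainTheorem13 : (i j : Fin 8) (σ : Permutation′ 9) → Path (S j) (applyS σ (S i))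
mainTheorem13 i j σ = path-trans (toS₁ j) (path-trans (path S₁-to-image) (path-relabel σ S₁-to-Sᵢ))
  where
  S₁-isSystem : IsSystem S₁
  S₁-isSystem = S-isSystem zero
  S₁-to-image : PathToImage S₁ σ
  S₁-to-image = pathToImage-all S₁-isSystem (pathToImage-transpositions (v 1) S₁-isSystem S₁-star) σ
  S₁-to-Sᵢ : Path S₁ (S i)
  S₁-to-Sᵢ = path-sym (S-isSystem i) S₁-isSystem (toS₁ i)
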